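{- Let $\mathcal{C}$ be a pure simplicial complex and let $F$ be a nonempty face of $\mathcal{C}$. Then $F$ is a shedding face of $\mathcal{C}$ if and only if for every $f\in F$ and every face $H\in\mathcal{C}$ with $F\subseteq H$, there exists a facet $H'$ of $\mathcal{C}$ such that $H\cap H'=H\setminus\{f\}$.
   Context: For a nonempty face $F$ of $\mathcal{C}$, $\mathrm{del}_F\mathcal{C}=\{G\in\mathcal{C}: F\not\subseteq G\}$. A face $F$ of a pure $d$-dimensional complex $\mathcal{C}$ is a shedding face if $\mathrm{del}_F\mathcal{C}$ is pure of dimension $d$ (the same dimension as $\mathcal{C}$). -}

module Defs where

open import Data.Nat using (ℕ; suc)
open import Data.Fin.Subset using (Subset; _⊆_; ∣_∣)
open import Data.Product using (_×_)
open import Relation.Nullary using (¬_; Dec)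
open import Relation.Binary.PropositionalEquality using (_≡_)

record Complex (n : ℕ) : Set₁ where
  field
    Face      : Subset n → Set
    face?     : (G : Subset n) → Dec (Face G)
    downClosed : ∀ {G H} → Face H → G ⊆ H → Face G
open Complex public

IsFacetOf : ∀ {n} → (Subset n → Set) → Subset n → Set
IsFacetOf P G = P G × (∀ H → P H → G ⊆ H → H ≡ G)

IsFacet : ∀ {n} → Complex n → Subset n → Set
IsFacet C G = IsFacetOf (Face C) G

-- Pure of dimension d: every facet has dimension d, i.e. d+1 vertices.
PureDim : ∀ {n} → (Subset n → Set) → ℕ → Set
PureDim P d = ∀ G → IsFacetOf P G → ∣ G ∣ ≡ suc d

del : ∀ {n} → Complex n → Subset n → Subset n → Set
del C F G = Face C G × ¬ (F ⊆ G)

IsSheddingFace : ∀ {n} → Complex n → ℕ → Subset n → Set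
IsSheddingFace C d F = PureDim (del C F) d

{-# OPTIONS --safe #-}
module Submission where

-- If F is shedding, a facet of del_F C containing H - f has the full size d + 1, so it is a facet
-- of C; it misses f, since otherwise it would contain F, and so cuts H in exactly H - f.
-- Conversely, let G be a facet of del_F C and K ⊇ G a facet of C. Either K avoids F, and then
-- K = G, or F ⊆ K and some f ∈ F is missing from G; the facet H′ with K ∩ H′ = K - f then
-- contains G and misses f, so it lies in del_F C and equals G. Either way G is a facet of C.

open import Defs
open import Data.Nat using (ℕ; suc; _≤_)
open import Data.Nat.Properties using (≤-reflexive; <⇒≱)
open import Data.Fin using (Fin)
open import Data.Fin.Properties using (any?; _≟_)
open import Data.Fin.Subset
  using (Subset; _⊆_; _⊈_; _⊄_; _⊃_; _∈_; _∉_; _∩_; _─_; _-_; ⁅_⁆; ∣_∣; Nonempty; outside)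
open import Data.Fin.Subset.Properties
  using (_∈?_; _⊆?_; _⊂?_; anySubset?; ⊆-refl; ⊆-trans; ⊆-antisym; p⊂q⇒p⊆q; p⊂q⇒∣p∣<∣q∣; p─q⊆p;
         x∈⁅x⁆; x∈p∩q⁺; x∈p∩q⁻; x∈p∧x≢y⇒x∈p-y)
open import Data.Fin.Subset.Induction using (Acc; acc; ⊃-wellFounded)
open import Data.Product using (∃; _×_; _,_; proj₁; proj₂)
open import Data.Vec using (_∷_; here; there)
open import Function.Bundles using (_⇔_; mk⇔)
open import Data.Empty using (⊥-elim)
open import Relation.Nullary using (Dec; yes; no)
open import Relation.Nullary.Decidable using (_×-dec_; ¬?; decidable-stable)
open import Relation.Binary.PropositionalEquality using (_≡_; refl; sym; subst)

private
  variable
    n : ℕ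
    p q : Subset n
    x : Fin n

p⊈q⇒∃x∈p∧x∉q : p ⊈ q → ∃ λ x → x ∈ p × x ∉ q
p⊈q⇒∃x∈p∧x∉q {p = p} {q} p⊈q with any? (λ x → x ∈? p ×-dec ¬? (x ∈? q))
... | yes witness = witness
... | no ∄ = ⊥-elim (p⊈q p⊆q)
  where
  p⊆q : p ⊆ q
  p⊆q {x} x∈p = decidable-stable (x ∈? q) (λ x∉q → ∄ (x , x∈p , x∉q))

p⊆q∧p⊄q⇒p≡q : p ⊆ q → p ⊄ q → p ≡ q
p⊆q∧p⊄q⇒p≡q p⊆q p⊄q = ⊆-antisym p⊆q q⊆p
  where
  q⊆p = decidable-stable (_ ⊆? _) (λ q⊈p → p⊄q (p⊆q , p⊈q⇒∃x∈p∧x∉q q⊈p))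

p⊆q∧∣q∣≤∣p∣⇒p≡q : p ⊆ q → ∣ q ∣ ≤ ∣ p ∣ → p ≡ q
p⊆q∧∣q∣≤∣p∣⇒p≡q p⊆q ∣q∣≤∣p∣ = p⊆q∧p⊄q⇒p≡q p⊆q (λ p⊂q → <⇒≱ (p⊂q⇒∣p∣<∣q∣ p⊂q) ∣q∣≤∣p∣)

x∈p─q⇒x∉q : ∀ {p q : Subset n} → x ∈ p ─ q → x ∉ q
x∈p─q⇒x∉q {p = _ ∷ _} {outside ∷ _} here ()
x∈p─q⇒x∉q {p = _ ∷ _} {_ ∷ _}       (there x∈p─q) (there x∈q) = x∈p─q⇒x∉q x∈p─q x∈q

x∉p-x : x ∉ p - x
x∉p-x {x = x} x∈p-x = x∈p─q⇒x∉q x∈p-x (x∈⁅x⁆ x)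

p⊆q∧x∉p⇒p⊆q-x : p ⊆ q → x ∉ p → p ⊆ q - x
p⊆q∧x∉p⇒p⊆q-x p⊆q x∉p y∈p = x∈p∧x≢y⇒x∈p-y (p⊆q y∈p) (λ { refl → x∉p y∈p })

p-x⊆q∧x∈q⇒p⊆q : p - x ⊆ q → x ∈ q → p ⊆ q
p-x⊆q∧x∈q⇒p⊆q {x = x} p-x⊆q x∈q {y} y∈p with y ≟ x
... | yes refl = x∈q
... | no y≢x = p-x⊆q (x∈p∧x≢y⇒x∈p-y y∈p y≢x)

p-x⊆q∧x∉q⇒p∩q≡p-x : p - x ⊆ q → x ∉ q → p ∩ q ≡ p - x
p-x⊆q∧x∉q⇒p∩q≡p-x {p = p} {x = x} p-x⊆q x∉q = ⊆-antisym p∩q⊆p-x p-x⊆p∩q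
  where
  p∩q⊆p-x : p ∩ _ ⊆ p - x
  p∩q⊆p-x y∈p∩q = let y∈p , y∈q = x∈p∩q⁻ _ _ y∈p∩q in
    x∈p∧x≢y⇒x∈p-y y∈p (λ { refl → x∉q y∈q })
  p-x⊆p∩q : p - x ⊆ p ∩ _
  p-x⊆p∩q y∈p-x = x∈p∩q⁺ (p─q⊆p p ⁅ x ⁆ y∈p-x , p-x⊆q y∈p-x)

p∩q≡p-x⇒p-x⊆q : p ∩ q ≡ p - x → p - x ⊆ q
p∩q≡p-x⇒p-x⊆q {p = p} {q} eq y∈p-x = proj₂ (x∈p∩q⁻ p q (subst (_ ∈_) (sym eq) y∈p-x))

p∩q≡p-x∧x∈p⇒x∉q : p ∩ q ≡ p - x → x ∈ p → x ∉ q
p∩q≡p-x∧x∈p⇒x∉q eq x∈p x∈q = x∉p-x (subst (_ ∈_) eq (x∈p∩q⁺ (x∈p , x∈q)))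

module _ {P : Subset n → Set} (P? : (G : Subset n) → Dec (P G)) where

  extend-to-facet : ∀ {G} → P G → ∃ λ K → IsFacetOf P K × G ⊆ K
  extend-to-facet = go (⊃-wellFounded _)
    where
    go : ∀ {G} → Acc _⊃_ G → P G → ∃ λ K → IsFacetOf P K × G ⊆ K
    go {G} (acc larger) PG with anySubset? (λ H → P? H ×-dec G ⊂? H)
    ... | yes (H , PH , G⊂H) =
      let K , facetK , H⊆K = go (larger G⊂H) PH in K , facetK , ⊆-trans (p⊂q⇒p⊆q G⊂H) H⊆K
    ... | no ∄ = G , (PG , λ H PH G⊆H → sym (p⊆q∧p⊄q⇒p≡q G⊆H (λ G⊂H → ∄ (H , PH , G⊂H)))) , ⊆-refl

  pure∧∣G∣≡suc-d⇒facet : ∀ {d G} → PureDim P d → P G → ∣ G ∣ ≡ suc d → IsFacetOf P G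
  pure∧∣G∣≡suc-d⇒facet pure PG ∣G∣≡1+d with extend-to-facet PG
  ... | K , facetK , G⊆K = subst (IsFacetOf P) (sym G≡K) facetK
    where
    G≡K = p⊆q∧∣q∣≤∣p∣⇒p≡q G⊆K (≤-reflexive (subst (∣ K ∣ ≡_) (sym ∣G∣≡1+d) (pure K facetK)))

module _ (C : Complex n) (F : Subset n) where

  DelFacetsAreFacets : Set
  DelFacetsAreFacets = ∀ {G} → IsFacetOf (del C F) G → IsFacet C G

  VertexAvoidingFacets : Set
  VertexAvoidingFacets =
    ∀ f → f ∈ F → ∀ H → Face C H → F ⊆ H → ∃ λ H′ → IsFacet C H′ × H ∩ H′ ≡ H - f

  del? : (G : Subset n) → Dec (del C F G)
  del? G = face? C G ×-dec ¬? (F ⊆? G)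

  face-minus-vertex∈del : ∀ {f H} → f ∈ F → Face C H → del C F (H - f)
  face-minus-vertex∈del {f} {H} f∈F FH = downClosed C FH (p─q⊆p H ⁅ f ⁆) , λ F⊆H-f → x∉p-x (F⊆H-f f∈F)

  shedding⇒delFacetsAreFacets : ∀ {d} → PureDim (Face C) d → IsSheddingFace C d F → DelFacetsAreFacets
  shedding⇒delFacetsAreFacets pure shedding {G} facetG =
    pure∧∣G∣≡suc-d⇒facet (face? C) pure (proj₁ (proj₁ facetG)) (shedding G facetG)

  delFacetsAreFacets⇒vertexAvoidingFacets : DelFacetsAreFacets → VertexAvoidingFacets
  delFacetsAreFacets⇒vertexAvoidingFacets delFacetsAreFacets f f∈F H FH F⊆H
    with extend-to-facet del? (face-minus-vertex∈del f∈F FH)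
  ... | G , facetG@((_ , F⊈G) , _) , H-f⊆G =
    G , delFacetsAreFacets facetG , p-x⊆q∧x∉q⇒p∩q≡p-x H-f⊆G f∉G
    where
    f∉G : f ∉ G
    f∉G f∈G = F⊈G (⊆-trans F⊆H (p-x⊆q∧x∈q⇒p⊆q H-f⊆G f∈G))

  vertexAvoidingFacets⇒delFacetsAreFacets : VertexAvoidingFacets → DelFacetsAreFacets
  vertexAvoidingFacets⇒delFacetsAreFacets avoiding {G} ((FG , F⊈G) , maximal)
    with extend-to-facet (face? C) FG
  ... | K , facetK@(FK , _) , G⊆K with F ⊆? K
  ...   | no F⊈K = subst (IsFacet C) (maximal K (FK , F⊈K) G⊆K) facetK
  ...   | yes F⊆K with p⊈q⇒∃x∈p∧x∉q F⊈G
  ...     | f , f∈F , f∉G with avoiding f f∈F K FK F⊆K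
  ...       | H′ , facetH′@(FH′ , _) , K∩H′≡K-f = subst (IsFacet C) H′≡G facetH′
    where
    H′≡G : H′ ≡ G
    H′≡G = maximal H′
      (FH′ , λ F⊆H′ → p∩q≡p-x∧x∈p⇒x∉q K∩H′≡K-f (F⊆K f∈F) (F⊆H′ f∈F))
      (⊆-trans (p⊆q∧x∉p⇒p⊆q-x G⊆K f∉G) (p∩q≡p-x⇒p-x⊆q K∩H′≡K-f))

lemma2p5 : ∀ {n} (C : Complex n) (d : ℕ) → PureDim (Face C) d →
    (F : Subset n) → Face C F → Nonempty F →
    (IsSheddingFace C d F ⇔
    (∀ (f : Fin n) → f ∈ F → ∀ (H : Subset n) → Face C H → F ⊆ H →
    ∃ λ H′ → IsFacet C H′ × (H ∩ H′ ≡ H - f)))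
lemma2p5 C d pure F _ _ = mk⇔
  (λ shedding →
    delFacetsAreFacets⇒vertexAvoidingFacets C F (shedding⇒delFacetsAreFacets C F pure shedding))
  (λ avoiding G facetG → pure G (vertexAvoidingFacets⇒delFacetsAreFacets C F avoiding facetG))
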